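{- Let $G$ be a geodetic graph in which every vertex has degree at least $2$. Then every vertex of $G$ has at least two antipodes.
   Context: A geodesic is a shortest path; a graph is geodetic if between any two vertices there is exactly one geodesic. An antipode of a vertex $v$ of a connected graph is a vertex at maximum distance from $v$. -}

module Defs where

open import Data.Nat using (ℕ; zero; suc; _≤_)
open import Data.Fin using (Fin)
open import Data.Bool using (Bool; true; false; T; if_then_else_)
open import Data.List using (List; map; allFin)
open import Data.Nat.ListAction using (sum)
open import Data.Product using (Σ; ∃; _×_; _,_)
open import Relation.Binary.PropositionalEquality using (_≡_; _≢_)

record Graph (n : ℕ) : Set where
  field
    adj   : Fin n → Fin n → Bool
    sym   : ∀ u v → adj u v ≡ adj v u
    irrefl : ∀ v → adj v v ≡ false
open Graph public

module _ {n : ℕ} (G : Graph n) where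

  degree : Fin n → ℕ
  degree v = sum (map (λ w → if adj G v w then 1 else 0) (allFin n))

  data Walk : Fin n → Fin n → ℕ → Set where
    []  : ∀ {u} → Walk u u 0
    _∷_ : ∀ {u w v k} → T (adj G u w) → Walk w v k → Walk u v (suc k)

  IsGeodesic : ∀ {u v k} → Walk u v k → Set
  IsGeodesic {u} {v} {k} _ = ∀ k' → Walk u v k' → k ≤ k'

  Geodetic : Set
  Geodetic = ∀ u v →
      (Σ ℕ λ k → Σ (Walk u v k) IsGeodesic)
    × (∀ k k' (p : Walk u v k) (q : Walk u v k') → IsGeodesic p → IsGeodesic q →
         _≡_ {A = Σ ℕ (Walk u v)} (k , p) (k' , q))

  Dist : Fin n → Fin n → ℕ → Set
  Dist u v k = Σ (Walk u v k) IsGeodesic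

  IsAntipode : Fin n → Fin n → Set
  IsAntipode v w = Σ ℕ λ k → Dist v w k × (∀ x k' → Dist v x k' → k' ≤ k)

-- Pick a vertex w farthest from v. If some other vertex is equally far, both are antipodes.
-- Otherwise every neighbour of w is strictly closer to v than w, and w has two of them; the
-- geodesics to these two neighbours, extended by the edge into w, are two distinct geodesics
-- from v to w (their last-but-one vertices differ), contradicting geodeticity.
{-# OPTIONS --safe #-}
module Submission where

open import Defs
open import Data.Nat using (ℕ; suc; _≤_; _<_; s≤s⁻¹)
open import Data.Nat.Properties using (≤-trans; ≤-antisym; ≤∧≢⇒<; _≟_)
open import Data.Fin using (Fin; zero; suc)
import Data.Fin as Fin
open import Data.Fin.Properties using (suc-injective; any?)
open import Data.Product using (Σ; ∃; _×_; _,_; proj₁; proj₂)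
open import Data.Bool using (Bool; true; false; T; if_then_else_)
open import Data.Unit using (tt)
open import Data.Empty using (⊥; ⊥-elim)
open import Data.Sum using (_⊎_; inj₁; inj₂; [_,_])
open import Data.List using (allFin; tabulate)
open import Data.List.Properties using (map-tabulate)
open import Data.List.Extrema.Nat using (argmax; f[xs]≤f[argmax])
open import Data.List.Membership.Propositional.Properties using (∈-allFin)
import Data.List.Relation.Unary.All as All
open import Data.Nat.ListAction using (sum)
open import Function using (_∘_; id)
open import Relation.Nullary using (yes; no)
open import Relation.Nullary.Decidable using (_×-dec_; ¬?)
open import Relation.Binary.PropositionalEquality
  using (_≡_; _≢_; refl; cong; subst; module ≡-Reasoning) renaming (sym to ≡-sym)

count : ∀ {n} → (Fin n → Bool) → ℕ
count b = sum (tabulate (λ i → if b i then 1 else 0))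

1≤count⇒∃ : ∀ {n} (b : Fin n → Bool) → 1 ≤ count b → ∃ (T ∘ b)
1≤count⇒∃ {suc n} b h with b zero in eq
... | true  = zero , subst T (≡-sym eq) tt
... | false with x , bx ← 1≤count⇒∃ (b ∘ suc) h = suc x , bx

2≤count⇒∃-distinct : ∀ {n} (b : Fin n → Bool) → 2 ≤ count b →
  Σ (Fin n) λ x → Σ (Fin n) λ y → x ≢ y × T (b x) × T (b y)
2≤count⇒∃-distinct {suc n} b h with b zero in eq
... | true with x , bx ← 1≤count⇒∃ (b ∘ suc) (s≤s⁻¹ h) =
  zero , suc x , (λ ()) , subst T (≡-sym eq) tt , bx
... | false with x , y , x≢y , bx , by ← 2≤count⇒∃-distinct (b ∘ suc) h =
  suc x , suc y , x≢y ∘ suc-injective , bx , by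

module _ {n} (G : Graph n) where

  degree≡count : ∀ v → degree G v ≡ count (adj G v)
  degree≡count v = cong sum (map-tabulate id (λ w → if adj G v w then 1 else 0))

  2≤degree⇒distinct-neighbours : ∀ v → 2 ≤ degree G v →
    Σ (Fin n) λ x → Σ (Fin n) λ y → x ≢ y × T (adj G v x) × T (adj G v y)
  2≤degree⇒distinct-neighbours v h =
    2≤count⇒∃-distinct (adj G v) (subst (2 ≤_) (degree≡count v) h)

  adj-flip : ∀ {u v} → T (adj G u v) → T (adj G v u)
  adj-flip {u} {v} = subst T (Graph.sym G u v)

  adj⇒≢ : ∀ {u v} → T (adj G u v) → u ≢ v
  adj⇒≢ {u} e refl = subst T (irrefl G u) e

  snoc : ∀ {u x w k} → Walk G u x k → T (adj G x w) → Walk G u w (suc k)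
  snoc []      e = e ∷ []
  snoc (f ∷ p) e = f ∷ snoc p e

  -- `previous a p` is the vertex visited just before the end of p, or a if p is empty.
  previous : ∀ {u v k} → Fin n → Walk G u v k → Fin n
  previous a       []      = a
  previous {u} _   (_ ∷ p) = previous u p

  previous-snoc : ∀ {u x w k} a (p : Walk G u x k) (e : T (adj G x w)) → previous a (snoc p e) ≡ x
  previous-snoc _ []      _ = refl
  previous-snoc _ (_ ∷ p) e = previous-snoc _ p e

  snoc-injective : ∀ {u x y w k l} (p : Walk G u x k) (q : Walk G u y l)
    (e : T (adj G x w)) (f : T (adj G y w)) →
    _≡_ {A = Σ ℕ (Walk G u w)} (suc k , snoc p e) (suc l , snoc q f) → x ≡ y
  snoc-injective {u} {x} {y} p q e f eq = begin
    x                   ≡⟨ previous-snoc u p e ⟨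
    previous u (snoc p e) ≡⟨ cong (λ (_ , r) → previous u r) eq ⟩
    previous u (snoc q f) ≡⟨ previous-snoc u q f ⟩
    y                   ∎
    where open ≡-Reasoning

module GeodeticDistance {n} {G : Graph n} (geodetic : Geodetic G) where

  dist : Fin n → Fin n → ℕ
  dist u v = proj₁ (proj₁ (geodetic u v))

  geodesic : ∀ u v → Dist G u v (dist u v)
  geodesic u v = proj₂ (proj₁ (geodetic u v))

  Dist⇒≡dist : ∀ {u v k} → Dist G u v k → k ≡ dist u v
  Dist⇒≡dist {u} {v} (p , p-geo) = ≤-antisym (p-geo _ (proj₁ (geodesic u v))) (proj₂ (geodesic u v) _ p)

  farthest⇒IsAntipode : ∀ {v x} → (∀ y → dist v y ≤ dist v x) → IsAntipode G v x
  farthest⇒IsAntipode {v} {x} farthest =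
    dist v x , geodesic v x , λ y k D → subst (_≤ dist v x) (≡-sym (Dist⇒≡dist D)) (farthest y)

  snoc-geodesic : ∀ {u x w} (e : T (adj G x w)) → dist u x < dist u w →
    IsGeodesic G (snoc G (proj₁ (geodesic u x)) e)
  snoc-geodesic {u} {w = w} _ closer k q = ≤-trans closer (proj₂ (geodesic u w) k q)

  closer-neighbour-unique : ∀ {u w x y} (e : T (adj G w x)) (f : T (adj G w y)) →
    dist u x < dist u w → dist u y < dist u w → x ≡ y
  closer-neighbour-unique {u} {w} {x} {y} e f x-closer y-closer =
    snoc-injective G (proj₁ (geodesic u x)) (proj₁ (geodesic u y)) e′ f′
      (proj₂ (geodetic u w) _ _ _ _ (snoc-geodesic e′ x-closer) (snoc-geodesic f′ y-closer))
    where
    e′ : T (adj G x w)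
    e′ = adj-flip G e
    f′ : T (adj G y w)
    f′ = adj-flip G f

  farthest-from : ∀ u → Σ (Fin n) λ w → ∀ y → dist u y ≤ dist u w
  farthest-from u =
    argmax (dist u) u (allFin n) , λ y → All.lookup (f[xs]≤f[argmax] u (allFin n)) (∈-allFin y)

  another-farthest-⊎-neighbours-closer : ∀ {u w} → (∀ y → dist u y ≤ dist u w) →
    (Σ (Fin n) λ x → x ≢ w × dist u x ≡ dist u w) ⊎ (∀ {z} → T (adj G w z) → dist u z < dist u w)
  another-farthest-⊎-neighbours-closer {u} {w} w-farthest
    with any? (λ x → ¬? (x Fin.≟ w) ×-dec (dist u x ≟ dist u w))
  ... | yes found = inj₁ found
  ... | no none = inj₂ λ {z} e → ≤∧≢⇒< (w-farthest z) (λ same → none (z , adj⇒≢ G e ∘ ≡-sym , same))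

proposition8 : ∀ {n} (G : Graph n) → Geodetic G → (∀ v → 2 ≤ degree G v) →
    ∀ v → Σ (Fin n) λ a → Σ (Fin n) λ b → a ≢ b × IsAntipode G v a × IsAntipode G v b
proposition8 {n} G geodetic 2≤degree v =
  [ two-antipodes , ⊥-elim ∘ unique-geodesic-violated ] (another-farthest-⊎-neighbours-closer w-farthest)
  where
  open GeodeticDistance geodetic
  w : Fin n
  w = proj₁ (farthest-from v)
  w-farthest : ∀ y → dist v y ≤ dist v w
  w-farthest = proj₂ (farthest-from v)
  two-antipodes : (Σ (Fin n) λ x → x ≢ w × dist v x ≡ dist v w) →
    Σ (Fin n) λ a → Σ (Fin n) λ b → a ≢ b × IsAntipode G v a × IsAntipode G v b
  two-antipodes (x , x≢w , same) =
    w , x , x≢w ∘ ≡-sym , farthest⇒IsAntipode w-farthest ,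
    farthest⇒IsAntipode (λ y → subst (dist v y ≤_) (≡-sym same) (w-farthest y))
  unique-geodesic-violated : (∀ {z} → T (adj G w z) → dist v z < dist v w) → ⊥
  unique-geodesic-violated closer with x , y , x≢y , e , f ← 2≤degree⇒distinct-neighbours G w (2≤degree w) =
    x≢y (closer-neighbour-unique e f (closer e) (closer f))
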